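{- Let $\mathbf{A}=\langle A,\cdot,\lnot\rangle$ be an a-involutive left-normal band. The following are equivalent: (1) $\mathbf{A}\vDash x\cdot\lnot x\approx x\cdot\lnot x\cdot y\cdot\lnot y$; (2) $\mathbf{A}\vDash x\cdot\lnot x\approx x\cdot\lnot x\cdot y$; (3) $\mathbf{A}/\mathcal{D}\in\mathcal{BISL}$.
   Context: A band is an idempotent semigroup; it is left-normal if it satisfies $xyz\approx xzy$. An a-involutive band is an algebra $\langle A,\cdot,\lnot\rangle$ where $\langle A,\cdot\rangle$ is a band, $\lnot\lnot x\approx x$, and $\lnot(x\cdot y)\approx \lnot x\cdot\lnot y$. Green's relation $\mathcal{D}$ on a band is defined by $a\,\mathcal{D}\,b$ iff $aba=a$ and $bab=b$; for an a-involutive left-normal band, $\mathcal{D}$ is a congruence of $\langle A,\cdot,\lnot\rangle$ and $\mathbf{A}/\mathcal{D}$ is an involutive semilattice (a semilattice $\langle I,\lor\rangle$ with an operation $\lnot$ satisfying $\lnot\lnot x\approx x$ and $\lnot(x\lor y)\approx\lnot x\lor\lnot y$). $\mathcal{BISL}$ is the variety of involutive semilattices satisfying $x\lor\lnot x\approx(x\lor\lnot x)\lor y$. -}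

module Defs where

open import Level using (Level; _⊔_; suc)
open import Relation.Binary.PropositionalEquality using (_≡_)
open import Relation.Binary.Structures using (IsEquivalence)
open import Data.Product using (_×_)

record ALNBand (a : Level) : Set (suc a) where
  infixl 7 _·_
  field
    Carrier    : Set a
    _·_        : Carrier → Carrier → Carrier
    ¬_         : Carrier → Carrier
    assoc      : ∀ x y z → (x · y) · z ≡ x · (y · z)
    idem       : ∀ x → x · x ≡ x
    leftNormal : ∀ x y z → x · y · z ≡ x · z · y
    invol      : ∀ x → ¬ (¬ x) ≡ x
    ¬-hom      : ∀ x y → ¬ (x · y) ≡ (¬ x) · (¬ y)

  _𝒟_ : Carrier → Carrier → Set a
  x 𝒟 y = (x · y · x ≡ x) × (y · x · y ≡ y)

record IsInvolutiveSemilattice {a ℓ : Level} (I : Set a) (_≈_ : I → I → Set ℓ)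
    (_∨_ : I → I → I) (¬_ : I → I) : Set (a ⊔ ℓ) where
  field
    isEquivalence : IsEquivalence _≈_
    ∨-cong : ∀ {x x′ y y′} → x ≈ x′ → y ≈ y′ → (x ∨ y) ≈ (x′ ∨ y′)
    ¬-cong : ∀ {x x′} → x ≈ x′ → (¬ x) ≈ (¬ x′)
    ∨-assoc : ∀ x y z → ((x ∨ y) ∨ z) ≈ (x ∨ (y ∨ z))
    ∨-comm  : ∀ x y → (x ∨ y) ≈ (y ∨ x)
    ∨-idem  : ∀ x → (x ∨ x) ≈ x
    ¬-invol : ∀ x → (¬ (¬ x)) ≈ x
    ¬-hom   : ∀ x y → (¬ (x ∨ y)) ≈ ((¬ x) ∨ (¬ y))

record InBISL {a ℓ : Level} (I : Set a) (_≈_ : I → I → Set ℓ)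
    (_∨_ : I → I → I) (¬_ : I → I) : Set (a ⊔ ℓ) where
  field
    isInvSL : IsInvolutiveSemilattice I _≈_ _∨_ ¬_
    bisl    : ∀ x y → (x ∨ (¬ x)) ≈ ((x ∨ (¬ x)) ∨ y)

-- The quotient A/𝒟, presented as the setoid (A, 𝒟) with the induced
-- operations (the class of x·y is [x]∨[y], the class of ¬x is ¬[x]).
QuotientInBISL : ∀ {a} → ALNBand a → Set a
QuotientInBISL A = InBISL Carrier _𝒟_ _·_ ¬_
  where open ALNBand A

Id1 : ∀ {a} → ALNBand a → Set a
Id1 A = ∀ x y → x · (¬ x) ≡ x · (¬ x) · y · (¬ y)
  where open ALNBand A

Id2 : ∀ {a} → ALNBand a → Set a
Id2 A = ∀ x y → x · (¬ x) ≡ x · (¬ x) · y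
  where open ALNBand A

-- In a left-normal band xyx = xy, so a 𝒟 b just says ab = a and ba = b; with
-- this description 𝒟 is a congruence and A/𝒟 an involutive semilattice whose
-- join is ·.  Equality in A/𝒟 of x·¬x and x·¬x·y is then exactly identity (2),
-- and (1) and (2) are interderivable by substituting ¬y or y for y.
module Submission where

open import Defs
open import Level using (Level)
open import Data.Product using (_×_; _,_)
open import Function.Bundles using (_⇔_; mk⇔)
open import Relation.Binary.PropositionalEquality
open import Relation.Binary.Structures using (IsEquivalence)

module _ {a : Level} (A : ALNBand a) where
  open ALNBand A
  open ≡-Reasoning

  leftRegular : ∀ x y → x · y · x ≡ x · y
  leftRegular x y = trans (leftNormal x y x) (cong (_· y) (idem x))

  𝒟-intro : ∀ {x y} → x · y ≡ x → y · x ≡ y → x 𝒟 y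
  𝒟-intro {x} {y} xy≡x yx≡y =
    trans (cong (_· x) xy≡x) (idem x) , trans (cong (_· y) yx≡y) (idem y)

  𝒟⇒·≡ˡ : ∀ {x y} → x 𝒟 y → x · y ≡ x
  𝒟⇒·≡ˡ {x} {y} (xyx≡x , _) = trans (sym (leftRegular x y)) xyx≡x

  𝒟⇒·≡ʳ : ∀ {x y} → x 𝒟 y → y · x ≡ y
  𝒟⇒·≡ʳ {x} {y} (_ , yxy≡y) = trans (sym (leftRegular y x)) yxy≡y

  ≡⇒𝒟 : ∀ {x y} → x ≡ y → x 𝒟 y
  ≡⇒𝒟 {x} refl = 𝒟-intro (idem x) (idem x)

  𝒟-sym : ∀ {x y} → x 𝒟 y → y 𝒟 x
  𝒟-sym (xyx≡x , yxy≡y) = yxy≡y , xyx≡x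

  𝒟-trans : ∀ {x y z} → x 𝒟 y → y 𝒟 z → x 𝒟 z
  𝒟-trans {x} {y} {z} x𝒟y y𝒟z = 𝒟-intro xz≡x zx≡z
    where
    xz≡x : x · z ≡ x
    xz≡x = begin
      x · z        ≡⟨ cong (_· z) (sym (𝒟⇒·≡ˡ x𝒟y)) ⟩
      x · y · z    ≡⟨ assoc x y z ⟩
      x · (y · z)  ≡⟨ cong (x ·_) (𝒟⇒·≡ˡ y𝒟z) ⟩
      x · y        ≡⟨ 𝒟⇒·≡ˡ x𝒟y ⟩
      x            ∎
    zx≡z : z · x ≡ z
    zx≡z = begin
      z · x        ≡⟨ cong (_· x) (sym (𝒟⇒·≡ʳ y𝒟z)) ⟩
      z · y · x    ≡⟨ assoc z y x ⟩
      z · (y · x)  ≡⟨ cong (z ·_) (𝒟⇒·≡ʳ x𝒟y) ⟩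
      z · y        ≡⟨ 𝒟⇒·≡ʳ y𝒟z ⟩
      z            ∎

  𝒟-isEquivalence : IsEquivalence _𝒟_
  𝒟-isEquivalence = record
    { refl  = ≡⇒𝒟 refl
    ; sym   = 𝒟-sym
    ; trans = 𝒟-trans
    }

  ·-absorbs-𝒟 : ∀ {x x′ y y′} → x 𝒟 x′ → y 𝒟 y′ → (x · y) · (x′ · y′) ≡ x · y
  ·-absorbs-𝒟 {x} {x′} {y} {y′} x𝒟x′ y𝒟y′ = begin
    (x · y) · (x′ · y′)  ≡⟨ sym (assoc (x · y) x′ y′) ⟩
    x · y · x′ · y′      ≡⟨ cong (_· y′) (leftNormal x y x′) ⟩
    x · x′ · y · y′      ≡⟨ cong (λ t → t · y · y′) (𝒟⇒·≡ˡ x𝒟x′) ⟩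
    x · y · y′           ≡⟨ assoc x y y′ ⟩
    x · (y · y′)         ≡⟨ cong (x ·_) (𝒟⇒·≡ˡ y𝒟y′) ⟩
    x · y                ∎

  ·-cong-𝒟 : ∀ {x x′ y y′} → x 𝒟 x′ → y 𝒟 y′ → (x · y) 𝒟 (x′ · y′)
  ·-cong-𝒟 x𝒟x′ y𝒟y′ =
    𝒟-intro (·-absorbs-𝒟 x𝒟x′ y𝒟y′) (·-absorbs-𝒟 (𝒟-sym x𝒟x′) (𝒟-sym y𝒟y′))

  ¬-cong-𝒟 : ∀ {x y} → x 𝒟 y → (¬ x) 𝒟 (¬ y)
  ¬-cong-𝒟 {x} {y} x𝒟y =
    𝒟-intro (trans (sym (¬-hom x y)) (cong ¬_ (𝒟⇒·≡ˡ x𝒟y)))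
            (trans (sym (¬-hom y x)) (cong ¬_ (𝒟⇒·≡ʳ x𝒟y)))

  ·-absorbs-swap : ∀ x y → (x · y) · (y · x) ≡ x · y
  ·-absorbs-swap x y = begin
    (x · y) · (y · x)  ≡⟨ sym (assoc (x · y) y x) ⟩
    x · y · y · x      ≡⟨ cong (_· x) (assoc x y y) ⟩
    x · (y · y) · x    ≡⟨ cong (λ t → x · t · x) (idem y) ⟩
    x · y · x          ≡⟨ leftRegular x y ⟩
    x · y              ∎

  ·-comm-𝒟 : ∀ x y → (x · y) 𝒟 (y · x)
  ·-comm-𝒟 x y = 𝒟-intro (·-absorbs-swap x y) (·-absorbs-swap y x)

  quotient-isInvolutiveSemilattice : IsInvolutiveSemilattice Carrier _𝒟_ _·_ ¬_
  quotient-isInvolutiveSemilattice = record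
    { isEquivalence = 𝒟-isEquivalence
    ; ∨-cong  = ·-cong-𝒟
    ; ¬-cong  = ¬-cong-𝒟
    ; ∨-assoc = λ x y z → ≡⇒𝒟 (assoc x y z)
    ; ∨-comm  = ·-comm-𝒟
    ; ∨-idem  = λ x → ≡⇒𝒟 (idem x)
    ; ¬-invol = λ x → ≡⇒𝒟 (invol x)
    ; ¬-hom   = λ x y → ≡⇒𝒟 (¬-hom x y)
    }

  Id1⇒Id2 : Id1 A → Id2 A
  Id1⇒Id2 id1 x y = sym (begin
    x · ¬ x · y              ≡⟨ cong (_· y) (id1 x y) ⟩
    x · ¬ x · y · ¬ y · y    ≡⟨ leftNormal (x · ¬ x · y) (¬ y) y ⟩
    x · ¬ x · y · y · ¬ y    ≡⟨ cong (_· ¬ y) (assoc (x · ¬ x) y y) ⟩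
    x · ¬ x · (y · y) · ¬ y  ≡⟨ cong (λ t → x · ¬ x · t · ¬ y) (idem y) ⟩
    x · ¬ x · y · ¬ y        ≡⟨ sym (id1 x y) ⟩
    x · ¬ x                  ∎)

  Id2⇒Id1 : Id2 A → Id1 A
  Id2⇒Id1 id2 x y = begin
    x · ¬ x            ≡⟨ id2 x (¬ y) ⟩
    x · ¬ x · ¬ y      ≡⟨ cong (_· ¬ y) (id2 x y) ⟩
    x · ¬ x · y · ¬ y  ∎

  Id2⇒QuotientInBISL : Id2 A → QuotientInBISL A
  Id2⇒QuotientInBISL id2 = record
    { isInvSL = quotient-isInvolutiveSemilattice
    ; bisl    = λ x y → ≡⇒𝒟 (id2 x y)
    }

  QuotientInBISL⇒Id2 : QuotientInBISL A → Id2 A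
  QuotientInBISL⇒Id2 q x y = sym (begin
    x · ¬ x · y                ≡⟨ cong (_· y) (sym (idem (x · ¬ x))) ⟩
    x · ¬ x · (x · ¬ x) · y    ≡⟨ assoc (x · ¬ x) (x · ¬ x) y ⟩
    x · ¬ x · (x · ¬ x · y)    ≡⟨ 𝒟⇒·≡ˡ (InBISL.bisl q x y) ⟩
    x · ¬ x                    ∎)

lemma3p6 : ∀ {a : Level} (A : ALNBand a) →
    ((Id1 A ⇔ Id2 A) × (Id2 A ⇔ QuotientInBISL A))
lemma3p6 A =
  mk⇔ (Id1⇒Id2 A) (Id2⇒Id1 A) , mk⇔ (Id2⇒QuotientInBISL A) (QuotientInBISL⇒Id2 A)
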